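{- Let $\mathbf{b}=(b_k)_{k\ge 0}$ be an arbitrary sequence with generating function $f(x)=\sum_{k\ge0}b_kx^k$, and define the sequence $\mathbf{a}=(a_k)_{k\ge0}$ by $\mathbf{a}=\mathbf{b}\,C^{ -1}$. Then the run transform of $\mathbf{b}$ is \[ \Phi\big(f(x)\big)=\sum_{k\ge 0}a_k x^k C(x,y)^{k+1}. \]
   Context: The run transform is $\Phi\big(f(x)\big)=\frac{1-x}{1-xy}\,f\!\left(\frac{x(1-x)}{1-xy}\right)$; the run transform of a sequence is that of its ordinary generating function. $C(x)=\frac{1-\sqrt{1-4x}}{2x}$ is the Catalan generating function and $C(x,y):=\Phi(C(x))=\frac{1-\sqrt{1-4\frac{x(1-x)}{1-xy}}}{2x}$. The Catalan matrix is the infinite upper triangular matrix $C=\left(\binom{2j-i}{j-i}-\binom{2j-i}{j-i-1}\right)_{i,j\ge0}$ (with $\binom{n}{m}=0$ for $m<0$), whose inverse is $C^{ -1}=\left((-1)^{j-i}\binom{i+1}{j-i}\right)_{i,j\ge0}$. Sequences are treated as row vectors, so $\mathbf{b}\,C^{ -1}$ is a vector–matrix product (each entry a finite sum). -}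

module Defs where

open import Algebra.Bundles using (CommutativeRing)
open import Data.Nat as ℕ using (ℕ; zero; suc; _∸_; _≤?_)
open import Data.Nat.Combinatorics using (_C_)
open import Relation.Nullary using (yes; no)

-- Catalan numbers as the 0-th row of the Catalan matrix:
-- C_{0,j} = binom(2j, j) - binom(2j, j-1)   (binom(n,m) = 0 for m < 0)
catalan : ℕ → ℕ
catalan zero    = 1
catalan (suc n) = ((2 ℕ.* suc n) C suc n) ∸ ((2 ℕ.* suc n) C n)

-- A series F is represented by its coefficients:
-- F i j = [x^i y^j] F.  Univariate series in x have F i j = 0 for j > 0.
module Series {c ℓ} (R : CommutativeRing c ℓ) where
  open CommutativeRing R

  FPS2 : Set c
  FPS2 = ℕ → ℕ → Carrier

  ι : ℕ → Carrier
  ι zero    = 0#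
  ι (suc n) = 1# + ι n

  sgn : ℕ → Carrier
  sgn zero    = 1#
  sgn (suc n) = - sgn n

  sumTo : ℕ → (ℕ → Carrier) → Carrier
  sumTo zero    f = 0#
  sumTo (suc n) f = sumTo n f + f n

  _⊛_ : FPS2 → FPS2 → FPS2
  (F ⊛ G) i j = sumTo (suc i) λ a → sumTo (suc j) λ b → F a b * G (i ∸ a) (j ∸ b)

  one : FPS2
  one zero zero = 1#
  one _    _    = 0#

  _^ˢ_ : FPS2 → ℕ → FPS2
  F ^ˢ zero  = one
  F ^ˢ suc n = F ⊛ (F ^ˢ n)

  _•_ : Carrier → FPS2 → FPS2
  (r • F) i j = r * F i j

  oneMinusX : FPS2
  oneMinusX zero    zero = 1#
  oneMinusX (suc zero) zero = - 1#
  oneMinusX _ _ = 0#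

  invOneMinusXY : FPS2
  invOneMinusXY i j with i ℕ.≟ j
  ... | yes _ = 1#
  ... | no  _ = 0#

  -- The (formal) infinite sum Σ_{k ≥ 0} x^k F_k, well defined since the
  -- coefficient of x^i y^j only involves k ≤ i.
  xsum : (ℕ → FPS2) → FPS2
  xsum F i j = sumTo (suc i) λ k → F k (i ∸ k) j

  -- h = (1-x)/(1-xy), so that x(1-x)/(1-xy) = x·h
  h : FPS2
  h = oneMinusX ⊛ invOneMinusXY

  substXh : (ℕ → Carrier) → FPS2
  substXh b = xsum λ k → b k • (h ^ˢ k)

  -- run transform of the sequence b (i.e. of its generating function):
  -- Φ(f)(x) = (1-x)/(1-xy) · f( x(1-x)/(1-xy) )
  Φ : (ℕ → Carrier) → FPS2
  Φ b = h ⊛ substXh b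

  Cxy : FPS2
  Cxy = Φ (λ n → ι (catalan n))

  Cinv : ℕ → ℕ → Carrier
  Cinv i j with i ≤? j
  ... | yes _ = sgn (j ∸ i) * ι (suc i C (j ∸ i))
  ... | no  _ = 0#

  -- a = b C^{-1} (row vector times matrix); since C^{-1} is upper
  -- triangular, a_j = Σ_{i ≤ j} b_i (C^{-1})_{i,j}
  rowTimesCinv : (ℕ → Carrier) → ℕ → Carrier
  rowTimesCinv b j = sumTo (suc j) λ i → b i * Cinv i j

  _≈ˢ_ : FPS2 → FPS2 → Set ℓ
  F ≈ˢ G = ∀ i j → F i j ≈ G i j

-- Write h = (1 − x)/(1 − xy), so that Φ(f) = h · f(x h) and C(x,y) = Z := h · C(x h).
-- The Catalan equation C = 1 + x C² turns into Z (1 − x Z) = h, hence by the binomial theorem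
--   h^(i+1) = Z^(i+1) (1 − x Z)^(i+1) = Σₘ (−1)ᵐ binom(i+1, m) xᵐ Z^(i+1+m).
-- Substituting this into Φ(f) = Σᵢ bᵢ xⁱ h^(i+1) and collecting powers of x produces exactly the
-- entries of C⁻¹; no property of h is used.  The Catalan recurrence itself is obtained from the
-- binomial formula for the Catalan numbers through the ballot numbers [xⁿ] C(x)ᵐ.
module Submission where

open import Defs
open import Algebra.Bundles using (CommutativeRing)
open import Algebra.Morphism.Structures using (module RingMorphisms)
import Algebra.Morphism.Construct.Composition as Composition
open import Data.Nat as ℕ using (ℕ; zero; suc; _∸_; _≤_; _<_; s≤s⁻¹)
open import Data.Nat.Combinatorics using (_C_; nCk≡nC[n∸k]) renaming (nCk+nC[k+1]≡[n+1]C[k+1] to pascal)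
open import Data.Nat.Properties
  using ( n<1+n; m<n⇒m<1+n; n∸n≡0; m∸[m∸n]≡n; +-∸-assoc; ∸-+-assoc; m+[n∸m]≡n; m+n∸m≡n; m+n∸n≡m
        ; m≤m+n; ≤-trans; ≤-reflexive)
import Data.Nat.Properties as ℕₚ
open import Data.Nat.Tactic.RingSolver using (solve-∀)
open import Data.Product using (_,_)
open import Function using (_∘_)
open import Relation.Nullary using (yes; no; contradiction)
import Relation.Binary.PropositionalEquality as ≡
open ≡ using (cong₂)

module FiniteSums {c ℓ} (R : CommutativeRing c ℓ) where
  open CommutativeRing R
  open Series R using (sumTo)
  open import Relation.Binary.Reasoning.Setoid setoid

  sumTo-cong : ∀ n {f g : ℕ → Carrier} → (∀ k → f k ≈ g k) → sumTo n f ≈ sumTo n g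
  sumTo-cong zero    f≈g = refl
  sumTo-cong (suc n) f≈g = +-cong (sumTo-cong n f≈g) (f≈g n)

  sumTo-cong-< : ∀ n {f g : ℕ → Carrier} → (∀ {k} → k < n → f k ≈ g k) → sumTo n f ≈ sumTo n g
  sumTo-cong-< zero    f≈g = refl
  sumTo-cong-< (suc n) f≈g = +-cong (sumTo-cong-< n (f≈g ∘ m<n⇒m<1+n)) (f≈g (n<1+n n))

  sumTo-zero : ∀ n {f : ℕ → Carrier} → (∀ k → f k ≈ 0#) → sumTo n f ≈ 0#
  sumTo-zero zero    f≈0 = refl
  sumTo-zero (suc n) f≈0 = trans (+-cong (sumTo-zero n f≈0) (f≈0 n)) (+-identityˡ 0#)

  sumTo-distrib-+ : ∀ n f g → sumTo n (λ k → f k + g k) ≈ sumTo n f + sumTo n g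
  sumTo-distrib-+ zero    f g = sym (+-identityˡ 0#)
  sumTo-distrib-+ (suc n) f g = begin
    sumTo n (λ k → f k + g k) + (f n + g n)  ≈⟨ +-congʳ (sumTo-distrib-+ n f g) ⟩
    (sumTo n f + sumTo n g) + (f n + g n)    ≈⟨ +-assoc _ _ _ ⟩
    sumTo n f + (sumTo n g + (f n + g n))    ≈⟨ +-congˡ (trans (+-comm _ _) (+-assoc _ _ _)) ⟩
    sumTo n f + (f n + (g n + sumTo n g))    ≈⟨ sym (+-assoc _ _ _) ⟩
    sumTo (suc n) f + (g n + sumTo n g)      ≈⟨ +-congˡ (+-comm _ _) ⟩
    sumTo (suc n) f + sumTo (suc n) g        ∎

  *-distribˡ-sumTo : ∀ n a f → a * sumTo n f ≈ sumTo n (λ k → a * f k)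
  *-distribˡ-sumTo zero    a f = zeroʳ a
  *-distribˡ-sumTo (suc n) a f = trans (distribˡ a _ _) (+-congʳ (*-distribˡ-sumTo n a f))

  *-distribʳ-sumTo : ∀ n a f → sumTo n f * a ≈ sumTo n (λ k → f k * a)
  *-distribʳ-sumTo zero    a f = zeroˡ a
  *-distribʳ-sumTo (suc n) a f = trans (distribʳ a _ _) (+-congʳ (*-distribʳ-sumTo n a f))

  sumTo-suc : ∀ n f → sumTo (suc n) f ≈ f 0 + sumTo n (f ∘ suc)
  sumTo-suc zero    f = trans (+-identityˡ (f 0)) (sym (+-identityʳ (f 0)))
  sumTo-suc (suc n) f = trans (+-congʳ (sumTo-suc n f)) (+-assoc _ _ _)

  sumTo-reverse : ∀ n f → sumTo n f ≈ sumTo n (λ k → f (n ∸ suc k))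
  sumTo-reverse zero    f = refl
  sumTo-reverse (suc n) f = begin
    sumTo n f + f n                          ≈⟨ +-congʳ (sumTo-reverse n f) ⟩
    sumTo n (λ k → f (n ∸ suc k)) + f n      ≈⟨ +-comm _ _ ⟩
    f n + sumTo n (λ k → f (n ∸ suc k))      ≈⟨ sym (sumTo-suc n (λ k → f (n ∸ k))) ⟩
    sumTo (suc n) (λ k → f (n ∸ k))          ∎

  sumTo-antidiagonal-flip : ∀ n (f : ℕ → ℕ → Carrier) →
    sumTo (suc n) (λ a → f a (n ∸ a)) ≈ sumTo (suc n) (λ a → f (n ∸ a) a)
  sumTo-antidiagonal-flip n f = trans (sumTo-reverse (suc n) (λ a → f a (n ∸ a)))
    (sumTo-cong-< (suc n) λ k<1+n → reflexive (≡.cong (f _) (m∸[m∸n]≡n (s≤s⁻¹ k<1+n))))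

  -- Both sides sum f over the triangle { (a , b) | a + b ≤ n }, by diagonals and by rows.
  sumTo-antidiagonals : ∀ n (f : ℕ → ℕ → Carrier) →
    sumTo (suc n) (λ k → sumTo (suc k) λ a → f a (k ∸ a)) ≈
    sumTo (suc n) (λ a → sumTo (suc (n ∸ a)) (f a))
  sumTo-antidiagonals zero    f = refl
  sumTo-antidiagonals (suc n) f = begin
    sumTo (suc n) (λ k → sumTo (suc k) λ a → f a (k ∸ a)) + diagonal
      ≈⟨ +-congʳ (sumTo-antidiagonals n f) ⟩
    sumTo (suc n) (λ a → sumTo (suc (n ∸ a)) (f a)) + (sumTo (suc n) (λ a → f a (suc n ∸ a)) + f (suc n) (n ∸ n))
      ≈⟨ sym (+-assoc _ _ _) ⟩
    (sumTo (suc n) (λ a → sumTo (suc (n ∸ a)) (f a)) + sumTo (suc n) (λ a → f a (suc n ∸ a))) + f (suc n) (n ∸ n)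
      ≈⟨ +-congʳ (sym (sumTo-distrib-+ (suc n) _ _)) ⟩
    sumTo (suc n) (λ a → sumTo (suc (n ∸ a)) (f a) + f a (suc n ∸ a)) + f (suc n) (n ∸ n)
      ≈⟨ +-cong (sumTo-cong-< (suc n) (λ a<1+n → sym (row-extend (s≤s⁻¹ a<1+n)))) last-row ⟩
    sumTo (suc (suc n)) (λ a → sumTo (suc (suc n ∸ a)) (f a)) ∎
    where
    diagonal = sumTo (suc (suc n)) (λ a → f a (suc n ∸ a))
    row-extend : ∀ {a} → a ≤ n → sumTo (suc (suc n ∸ a)) (f a) ≈ sumTo (suc (n ∸ a)) (f a) + f a (suc n ∸ a)
    row-extend {a} a≤n rewrite +-∸-assoc 1 a≤n = refl
    last-row : f (suc n) (n ∸ n) ≈ sumTo (suc (n ∸ n)) (f (suc n))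
    last-row rewrite n∸n≡0 n = sym (+-identityˡ _)

  sumTo-triangle-swap : ∀ n (f : ℕ → ℕ → Carrier) →
    sumTo (suc n) (λ a → sumTo (suc (n ∸ a)) (f a)) ≈
    sumTo (suc n) (λ a → sumTo (suc (n ∸ a)) λ b → f b a)
  sumTo-triangle-swap n f = begin
    sumTo (suc n) (λ a → sumTo (suc (n ∸ a)) (f a))
      ≈⟨ sym (sumTo-antidiagonals n f) ⟩
    sumTo (suc n) (λ k → sumTo (suc k) λ a → f a (k ∸ a))
      ≈⟨ sumTo-cong (suc n) (λ k → sumTo-antidiagonal-flip k f) ⟩
    sumTo (suc n) (λ k → sumTo (suc k) λ a → f (k ∸ a) a)
      ≈⟨ sumTo-antidiagonals n (λ a b → f b a) ⟩
    sumTo (suc n) (λ a → sumTo (suc (n ∸ a)) λ b → f b a) ∎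

module PowerSeries {c ℓ} (R : CommutativeRing c ℓ) where
  open CommutativeRing R
  open Series R using (sumTo)
  open FiniteSums R
  open import Algebra.Properties.Ring ring using (-0#≈0#)
  open import Relation.Binary.Reasoning.Setoid setoid

  FPS : Set c
  FPS = ℕ → Carrier

  infix  4 _≈ₚ_
  infixl 6 _+ₚ_
  infixl 7 _*ₚ_

  _≈ₚ_ : FPS → FPS → Set ℓ
  F ≈ₚ G = ∀ n → F n ≈ G n

  _+ₚ_ : FPS → FPS → FPS
  (F +ₚ G) n = F n + G n

  -ₚ_ : FPS → FPS
  (-ₚ F) n = - F n

  _*ₚ_ : FPS → FPS → FPS
  (F *ₚ G) n = sumTo (suc n) λ a → F a * G (n ∸ a)

  0ₚ : FPS
  0ₚ _ = 0#

  const : Carrier → FPS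
  const a zero    = a
  const a (suc n) = 0#

  const-*ₚ : ∀ a F n → (const a *ₚ F) n ≈ a * F n
  const-*ₚ a F n = begin
    (const a *ₚ F) n                                 ≈⟨ sumTo-suc n _ ⟩
    a * F (n ∸ 0) + sumTo n (λ k → 0# * F (n ∸ suc k)) ≈⟨ +-congˡ (sumTo-zero n λ k → zeroˡ _) ⟩
    a * F n + 0#                                     ≈⟨ +-identityʳ _ ⟩
    a * F n                                          ∎

  *ₚ-cong : ∀ {F F′ G G′} → F ≈ₚ F′ → G ≈ₚ G′ → F *ₚ G ≈ₚ F′ *ₚ G′
  *ₚ-cong F≈F′ G≈G′ n = sumTo-cong (suc n) λ a → *-cong (F≈F′ a) (G≈G′ (n ∸ a))

  *ₚ-comm : ∀ F G → F *ₚ G ≈ₚ G *ₚ F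
  *ₚ-comm F G n = trans (sumTo-antidiagonal-flip n λ a b → F a * G b)
                        (sumTo-cong (suc n) λ a → *-comm _ _)

  *ₚ-identityˡ : ∀ F → const 1# *ₚ F ≈ₚ F
  *ₚ-identityˡ F n = trans (const-*ₚ 1# F n) (*-identityˡ _)

  *ₚ-distribˡ : ∀ F G H → F *ₚ (G +ₚ H) ≈ₚ F *ₚ G +ₚ F *ₚ H
  *ₚ-distribˡ F G H n = trans (sumTo-cong (suc n) λ a → distribˡ _ _ _) (sumTo-distrib-+ (suc n) _ _)

  *ₚ-assoc : ∀ F G H → (F *ₚ G) *ₚ H ≈ₚ F *ₚ (G *ₚ H)
  *ₚ-assoc F G H n = begin
    sumTo (suc n) (λ a → (F *ₚ G) a * H (n ∸ a))
      ≈⟨ sumTo-cong-< (suc n) (λ {a} _ → trans (*-distribʳ-sumTo (suc a) _ _)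
           (sumTo-cong-< (suc a) λ p<1+a → *-congˡ (reflexive (≡.cong (H ∘ (n ∸_))
             (≡.sym (m+[n∸m]≡n (s≤s⁻¹ p<1+a))))))) ⟩
    sumTo (suc n) (λ a → sumTo (suc a) λ p → f p (a ∸ p))
      ≈⟨ sumTo-antidiagonals n f ⟩
    sumTo (suc n) (λ p → sumTo (suc (n ∸ p)) (f p))
      ≈⟨ sumTo-cong (suc n) (λ p → trans (sumTo-cong (suc (n ∸ p)) λ q → trans (*-assoc _ _ _)
           (*-congˡ (*-congˡ (reflexive (≡.cong H (≡.sym (∸-+-assoc n p q)))))))
           (sym (*-distribˡ-sumTo (suc (n ∸ p)) (F p) _))) ⟩
    sumTo (suc n) (λ p → F p * (G *ₚ H) (n ∸ p)) ∎
    where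
    f : ℕ → ℕ → Carrier
    f p q = F p * G q * H (n ∸ (p ℕ.+ q))

  powerSeriesRing : CommutativeRing c ℓ
  powerSeriesRing = record
    { Carrier = FPS ; _≈_ = _≈ₚ_ ; _+_ = _+ₚ_ ; _*_ = _*ₚ_ ; -_ = -ₚ_ ; 0# = 0ₚ ; 1# = const 1#
    ; isCommutativeRing = record
      { isRing = record
        { +-isAbelianGroup = record
          { isGroup = record
            { isMonoid = record
              { isSemigroup = record
                { isMagma = record
                  { isEquivalence = record
                    { refl = λ n → refl ; sym = λ F≈G n → sym (F≈G n)
                    ; trans = λ F≈G G≈H n → trans (F≈G n) (G≈H n) }
                  ; ∙-cong = λ F≈F′ G≈G′ n → +-cong (F≈F′ n) (G≈G′ n) }
                ; assoc = λ F G H n → +-assoc (F n) (G n) (H n) }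
              ; identity = (λ F n → +-identityˡ (F n)) , (λ F n → +-identityʳ (F n)) }
            ; inverse = (λ F n → -‿inverseˡ (F n)) , (λ F n → -‿inverseʳ (F n))
            ; ⁻¹-cong = λ F≈G n → -‿cong (F≈G n) }
          ; comm = λ F G n → +-comm (F n) (G n) }
        ; *-cong = *ₚ-cong
        ; *-assoc = *ₚ-assoc
        ; *-identity = *ₚ-identityˡ , λ F n → trans (*ₚ-comm F (const 1#) n) (*ₚ-identityˡ F n)
        ; distrib = *ₚ-distribˡ , λ F G H n → trans (*ₚ-comm (G +ₚ H) F n)
            (trans (*ₚ-distribˡ F G H n) (+-cong (*ₚ-comm F G n) (*ₚ-comm F H n))) }
      ; *-comm = *ₚ-comm } }

  const-isRingHomomorphism :
    RingMorphisms.IsRingHomomorphism (CommutativeRing.rawRing R) (CommutativeRing.rawRing powerSeriesRing) const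
  const-isRingHomomorphism = record
    { isSemiringHomomorphism = record
      { isNearSemiringHomomorphism = record
        { +-isMonoidHomomorphism = record
          { isMagmaHomomorphism = record
            { isRelHomomorphism = record { cong = const-cong }
            ; homo = const-+ }
          ; ε-homo = λ { zero → refl ; (suc n) → refl } }
        ; *-homo = const-* }
      ; 1#-homo = λ n → refl }
    ; -‿homo = const-neg }
    where
    const-cong : ∀ {a b} → a ≈ b → const a ≈ₚ const b
    const-cong a≈b zero    = a≈b
    const-cong a≈b (suc n) = refl
    const-+ : ∀ a b → const (a + b) ≈ₚ const a +ₚ const b
    const-+ a b zero    = refl
    const-+ a b (suc n) = sym (+-identityˡ 0#)
    const-* : ∀ a b → const (a * b) ≈ₚ const a *ₚ const b
    const-* a b zero    = sym (const-*ₚ a (const b) 0)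
    const-* a b (suc n) = sym (trans (const-*ₚ a (const b) (suc n)) (zeroʳ a))
    const-neg : ∀ a → const (- a) ≈ₚ -ₚ const a
    const-neg a zero    = refl
    const-neg a (suc n) = sym (-0#≈0#)

  coeff-sumTo : ∀ n (Fs : ℕ → FPS) m → Series.sumTo powerSeriesRing n Fs m ≈ sumTo n (λ i → Fs i m)
  coeff-sumTo zero    Fs m = refl
  coeff-sumTo (suc n) Fs m = +-congʳ (coeff-sumTo n Fs m)

-- ballot n m is the coefficient of xⁿ in C(x)ᵐ; the recursion is Cᵐ⁺¹ = Cᵐ + x Cᵐ⁺².
ballot : ℕ → ℕ → ℕ
ballot zero    m       = 1
ballot (suc n) zero    = 0
ballot (suc n) (suc m) = ballot (suc n) m ℕ.+ ballot n (suc (suc m))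

module _ where
  open import Data.Nat using (_+_; _*_)
  open ≡ using (_≡_; cong; sym)
  open ≡.≡-Reasoning

  -- Stated additively, this is ballot (1 + n) (1 + m) = L C (1 + n) − L C n with L = 2 + 2n + m.
  ballot-binomial : ∀ n m → let L = suc n + suc n + m in ballot (suc n) (suc m) + L C n ≡ L C suc n
  ballot-binomial zero    zero    = ≡.refl
  ballot-binomial (suc p) zero    = begin
    ballot (suc p) 2 + L C suc p            ≡⟨ cong (λ k → ballot (suc p) 2 + k C suc p) L≡1+M ⟩
    ballot (suc p) 2 + suc M C suc p        ≡⟨ cong (ballot (suc p) 2 +_) (sym (pascal M p)) ⟩
    ballot (suc p) 2 + (M C p + M C suc p)  ≡⟨ sym (ℕₚ.+-assoc (ballot (suc p) 2) _ _) ⟩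
    ballot (suc p) 2 + M C p + M C suc p    ≡⟨ cong (_+ M C suc p) (ballot-binomial p 1) ⟩
    M C suc p + M C suc p                   ≡⟨ cong (M C suc p +_) M-central ⟩
    M C suc p + M C suc (suc p)             ≡⟨ pascal M (suc p) ⟩
    suc M C suc (suc p)                     ≡⟨ cong (_C suc (suc p)) (sym L≡1+M) ⟩
    L C suc (suc p)                         ∎
    where
    L M : ℕ
    L = suc (suc p) + suc (suc p) + 0
    M = suc p + suc p + 1
    L≡1+M : L ≡ suc M
    L≡1+M = eq p
      where eq : ∀ p → suc (suc p) + suc (suc p) + 0 ≡ suc (suc p + suc p + 1)
            eq = solve-∀
    M≡1+p+[2+p] : M ≡ suc p + suc (suc p)
    M≡1+p+[2+p] = eq p
      where eq : ∀ p → suc p + suc p + 1 ≡ suc p + suc (suc p)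
            eq = solve-∀
    M-central : M C suc p ≡ M C suc (suc p)
    M-central = ≡.trans (nCk≡nC[n∸k] (≤-trans (m≤m+n (suc p) (suc (suc p))) (≤-reflexive (sym M≡1+p+[2+p]))))
                        (cong (M C_) (≡.trans (cong (_∸ suc p) M≡1+p+[2+p]) (m+n∸m≡n (suc p) (suc (suc p)))))
  ballot-binomial zero    (suc m) = begin
    ballot 1 (suc m) + 1 + 1                ≡⟨ cong (_+ 1) (ballot-binomial zero m) ⟩
    (2 + m) C 1 + 1                         ≡⟨ ℕₚ.+-comm ((2 + m) C 1) 1 ⟩
    (2 + m) C 0 + (2 + m) C 1               ≡⟨ pascal (2 + m) 0 ⟩
    (3 + m) C 1                             ∎
  ballot-binomial (suc p) (suc m) = begin
    x + y + L C suc p                       ≡⟨ cong (λ k → x + y + k C suc p) L≡1+N ⟩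
    x + y + suc N C suc p                   ≡⟨ cong (x + y +_) (sym (pascal N p)) ⟩
    x + y + (N C p + N C suc p)             ≡⟨ interchange x y (N C p) (N C suc p) ⟩
    (x + N C suc p) + (y + N C p)           ≡⟨ cong₂ _+_ (ballot-binomial (suc p) m) previous-row ⟩
    N C suc (suc p) + N C suc p             ≡⟨ ℕₚ.+-comm (N C suc (suc p)) _ ⟩
    N C suc p + N C suc (suc p)             ≡⟨ pascal N (suc p) ⟩
    suc N C suc (suc p)                     ≡⟨ cong (_C suc (suc p)) (sym L≡1+N) ⟩
    L C suc (suc p)                         ∎
    where
    L N x y : ℕ
    L = suc (suc p) + suc (suc p) + suc m
    N = suc (suc p) + suc (suc p) + m
    x = ballot (suc (suc p)) (suc m)
    y = ballot (suc p) (suc (suc (suc m)))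
    L≡1+N : L ≡ suc N
    L≡1+N = ℕₚ.+-suc (suc (suc p) + suc (suc p)) m
    previous-row : y + N C p ≡ N C suc p
    previous-row = ≡.subst (λ k → y + k C p ≡ k C suc p) (N≡ p m) (ballot-binomial p (suc (suc m)))
      where N≡ : ∀ p m → suc p + suc p + suc (suc m) ≡ suc (suc p) + suc (suc p) + m
            N≡ = solve-∀
    interchange : ∀ a b c d → a + b + (c + d) ≡ (a + d) + (b + c)
    interchange = solve-∀

  catalan≡ballot : ∀ n → catalan n ≡ ballot n 1
  catalan≡ballot zero    = ≡.refl
  catalan≡ballot (suc n) = begin
    (2 * suc n) C suc n ∸ (2 * suc n) C n   ≡⟨ cong (λ k → k C suc n ∸ k C n) (eq n) ⟩
    L C suc n ∸ L C n                       ≡⟨ cong (_∸ L C n) (sym (ballot-binomial n 0)) ⟩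
    ballot (suc n) 1 + L C n ∸ L C n        ≡⟨ m+n∸n≡m (ballot (suc n) 1) (L C n) ⟩
    ballot (suc n) 1                        ∎
    where
    L : ℕ
    L = suc n + suc n + 0
    eq : ∀ n → 2 * suc n ≡ suc n + suc n + 0
    eq = solve-∀

module IntegerCoefficients {c ℓ} (R : CommutativeRing c ℓ) where
  open CommutativeRing R
  open Series R using (ι; sgn; sumTo)
  open FiniteSums R
  open import Relation.Binary.Reasoning.Setoid setoid

  ι-+ : ∀ m n → ι (m ℕ.+ n) ≈ ι m + ι n
  ι-+ zero    n = sym (+-identityˡ _)
  ι-+ (suc m) n = trans (+-congˡ (ι-+ m n)) (sym (+-assoc _ _ _))

  ι-1 : ι 1 ≈ 1#
  ι-1 = +-identityʳ 1#

  ι-ballot-convolution : ∀ n a b →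
    sumTo (suc n) (λ k → ι (ballot k a) * ι (ballot (n ∸ k) b)) ≈ ι (ballot n (a ℕ.+ b))
  ι-ballot-convolution zero a b = trans (+-identityˡ _) (trans (*-congʳ ι-1) (*-identityˡ _))
  ι-ballot-convolution (suc n) zero b = begin
    sumTo (suc (suc n)) (λ k → ι (ballot k 0) * ι (ballot (suc n ∸ k) b))
      ≈⟨ sumTo-suc (suc n) _ ⟩
    ι 1 * ι (ballot (suc n) b) + sumTo (suc n) (λ k → 0# * ι (ballot (n ∸ k) b))
      ≈⟨ +-cong (trans (*-congʳ ι-1) (*-identityˡ _)) (sumTo-zero (suc n) λ k → zeroˡ _) ⟩
    ι (ballot (suc n) b) + 0#
      ≈⟨ +-identityʳ _ ⟩
    ι (ballot (suc n) b) ∎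
  ι-ballot-convolution (suc n) (suc a) b = begin
    sumTo (suc (suc n)) (λ k → ι (ballot k (suc a)) * ι (ballot (suc n ∸ k) b))
      ≈⟨ sumTo-suc (suc n) _ ⟩
    first + sumTo (suc n) (λ k → ι (ballot (suc k) a ℕ.+ ballot k (suc (suc a))) * ι (ballot (n ∸ k) b))
      ≈⟨ +-congˡ (trans (sumTo-cong (suc n) λ k → trans (*-congʳ (ι-+ (ballot (suc k) a) _)) (distribʳ _ _ _))
                        (sumTo-distrib-+ (suc n) _ _)) ⟩
    first + (shifted + longer)
      ≈⟨ sym (+-assoc _ _ _) ⟩
    (first + shifted) + longer
      ≈⟨ +-cong (trans (sym (sumTo-suc (suc n) _)) (ι-ballot-convolution (suc n) a b))
                (ι-ballot-convolution n (suc (suc a)) b) ⟩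
    ι (ballot (suc n) (a ℕ.+ b)) + ι (ballot n (suc (suc (a ℕ.+ b))))
      ≈⟨ sym (ι-+ (ballot (suc n) (a ℕ.+ b)) _) ⟩
    ι (ballot (suc n) (suc a ℕ.+ b)) ∎
    where
    first shifted longer : Carrier
    first   = ι 1 * ι (ballot (suc n) b)
    shifted = sumTo (suc n) (λ k → ι (ballot (suc k) a) * ι (ballot (n ∸ k) b))
    longer  = sumTo (suc n) (λ k → ι (ballot k (suc (suc a))) * ι (ballot (n ∸ k) b))

  ι-catalan-suc : ∀ n → ι (catalan (suc n)) ≈ sumTo (suc n) (λ k → ι (catalan k) * ι (catalan (n ∸ k)))
  ι-catalan-suc n = begin
    ι (catalan (suc n))
      ≈⟨ reflexive (≡.cong ι (catalan≡ballot (suc n))) ⟩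
    ι (ballot n 2)
      ≈⟨ sym (ι-ballot-convolution n 1 1) ⟩
    sumTo (suc n) (λ k → ι (ballot k 1) * ι (ballot (n ∸ k) 1))
      ≈⟨ sumTo-cong (suc n) (λ k → reflexive (cong₂ (λ i j → ι i * ι j)
           (≡.sym (catalan≡ballot k)) (≡.sym (catalan≡ballot (n ∸ k))))) ⟩
    sumTo (suc n) (λ k → ι (catalan k) * ι (catalan (n ∸ k))) ∎

  signedBinomial : ℕ → ℕ → Carrier
  signedBinomial n m = sgn m * ι (n C m)

  signedBinomial-pascal : ∀ n m →
    signedBinomial (suc n) (suc m) + signedBinomial n m ≈ signedBinomial n (suc m)
  signedBinomial-pascal n m = begin
    - s * ι (suc n C suc m) + s * a         ≈⟨ +-congʳ (*-congˡ (reflexive (≡.cong ι (≡.sym (pascal n m))))) ⟩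
    - s * ι (n C m ℕ.+ n C suc m) + s * a   ≈⟨ +-congʳ (trans (*-congˡ (ι-+ (n C m) _)) (distribˡ _ _ _)) ⟩
    (- s * a + - s * b) + s * a             ≈⟨ +-congʳ (+-comm _ _) ⟩
    (- s * b + - s * a) + s * a             ≈⟨ +-assoc _ _ _ ⟩
    - s * b + (- s * a + s * a)             ≈⟨ +-congˡ (trans (sym (distribʳ a _ _)) (trans (*-congʳ (-‿inverseˡ s)) (zeroˡ a))) ⟩
    - s * b + 0#                            ≈⟨ +-identityʳ _ ⟩
    - s * b                                 ∎
    where
    s a b : Carrier
    s = sgn m
    a = ι (n C m)
    b = ι (n C suc m)

module RingHomomorphismLemmas {a b ℓ₁ ℓ₂} (R₁ : CommutativeRing a ℓ₁) (R₂ : CommutativeRing b ℓ₂)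
  {f : CommutativeRing.Carrier R₁ → CommutativeRing.Carrier R₂}
  (isHom : RingMorphisms.IsRingHomomorphism (CommutativeRing.rawRing R₁) (CommutativeRing.rawRing R₂) f)
  where
  open CommutativeRing R₂
  open RingMorphisms.IsRingHomomorphism isHom
  module S₁ = Series R₁
  module S₂ = Series R₂
  module I₁ = IntegerCoefficients R₁
  module I₂ = IntegerCoefficients R₂

  homo-sumTo : ∀ n g → f (S₁.sumTo n g) ≈ S₂.sumTo n (f ∘ g)
  homo-sumTo zero    g = 0#-homo
  homo-sumTo (suc n) g = trans (+-homo _ _) (+-congʳ (homo-sumTo n g))

  homo-ι : ∀ n → f (S₁.ι n) ≈ S₂.ι n
  homo-ι zero    = 0#-homo
  homo-ι (suc n) = trans (+-homo _ _) (+-cong 1#-homo (homo-ι n))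

  homo-sgn : ∀ n → f (S₁.sgn n) ≈ S₂.sgn n
  homo-sgn zero    = 1#-homo
  homo-sgn (suc n) = trans (-‿homo _) (-‿cong (homo-sgn n))

  homo-signedBinomial : ∀ n m → f (I₁.signedBinomial n m) ≈ I₂.signedBinomial n m
  homo-signedBinomial n m = trans (*-homo _ _) (*-cong (homo-sgn m) (homo-ι (n C m)))

module FormalXSums {c ℓ} (T : CommutativeRing c ℓ) where
  open PowerSeries T using (FPS; powerSeriesRing; const; coeff-sumTo; const-*ₚ)
  private
    module T = CommutativeRing T
    module ΣT = FiniteSums T
  open CommutativeRing powerSeriesRing
  open Series powerSeriesRing using (sumTo)
  open Series T using () renaming (sumTo to sumToᵀ)
  open import Relation.Binary.Reasoning.Setoid setoid

  X : FPS
  X zero    = T.0#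
  X (suc n) = const T.1# n

  xsum : (ℕ → FPS) → FPS
  xsum F n = sumToᵀ (suc n) λ k → F k (n ∸ k)

  xsum-cong : ∀ {F G} → (∀ k → F k ≈ G k) → xsum F ≈ xsum G
  xsum-cong F≈G n = ΣT.sumTo-cong (suc n) λ k → F≈G k (n ∸ k)

  xsum-zero : ∀ {F} → (∀ k → F k ≈ 0#) → xsum F ≈ 0#
  xsum-zero F≈0 n = ΣT.sumTo-zero (suc n) λ k → F≈0 k (n ∸ k)

  xsum-distrib-+ : ∀ F G → xsum (λ k → F k + G k) ≈ xsum F + xsum G
  xsum-distrib-+ F G n = ΣT.sumTo-distrib-+ (suc n) _ _

  *-distribˡ-xsum : ∀ B F → B * xsum F ≈ xsum (λ k → B * F k)
  *-distribˡ-xsum B F n = T.trans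
    (ΣT.sumTo-cong (suc n) λ a → ΣT.*-distribˡ-sumTo (suc (n ∸ a)) (B a) _)
    (T.trans (ΣT.sumTo-triangle-swap n λ a k → B a T.* F k (n ∸ a ∸ k))
             (ΣT.sumTo-cong (suc n) λ k → ΣT.sumTo-cong (suc (n ∸ k)) λ a →
               T.*-congˡ (T.reflexive (≡.cong (F k) (∸-comm n a k)))))
    where
    ∸-comm : ∀ n a k → n ∸ a ∸ k ≡.≡ n ∸ k ∸ a
    ∸-comm n a k = ≡.trans (∸-+-assoc n a k) (≡.trans (≡.cong (n ∸_) (ℕₚ.+-comm a k)) (≡.sym (∸-+-assoc n k a)))

  xsum-suc : ∀ F → xsum F ≈ F 0 + X * xsum (F ∘ suc)
  xsum-suc F zero    = T.trans (T.+-identityˡ _)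
    (T.sym (T.trans (T.+-congˡ (T.trans (T.+-identityˡ _) (T.zeroˡ _))) (T.+-identityʳ _)))
  xsum-suc F (suc n) = T.trans (ΣT.sumTo-suc (suc n) _) (T.+-congˡ (T.sym X-shift))
    where
    X-shift : (X * xsum (F ∘ suc)) (suc n) T.≈ xsum (F ∘ suc) n
    X-shift = T.trans (ΣT.sumTo-suc (suc n) _)
      (T.trans (T.+-cong (T.zeroˡ _) (const-*ₚ T.1# (xsum (F ∘ suc)) n))
               (T.trans (T.+-identityˡ _) (T.*-identityˡ _)))

  xsum-antidiagonals : ∀ (G : ℕ → ℕ → FPS) →
    xsum (λ k → sumTo (suc k) λ i → G i (k ∸ i)) ≈ xsum (λ i → xsum (G i))
  xsum-antidiagonals G n =
    T.trans by-diagonals (T.trans (ΣT.sumTo-antidiagonals n g) by-rows)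
    where
    g : ℕ → ℕ → T.Carrier
    g i m = G i m (n ∸ (i ℕ.+ m))
    by-diagonals : xsum (λ k → sumTo (suc k) λ i → G i (k ∸ i)) n
                   T.≈ sumToᵀ (suc n) (λ k → sumToᵀ (suc k) λ i → g i (k ∸ i))
    by-diagonals = ΣT.sumTo-cong-< (suc n) λ {k} _ → T.trans (coeff-sumTo (suc k) _ (n ∸ k))
      (ΣT.sumTo-cong-< (suc k) λ {i} i<1+k → T.reflexive (≡.cong (G i (k ∸ i) ∘ (n ∸_))
        (≡.sym (m+[n∸m]≡n (s≤s⁻¹ i<1+k)))))
    by-rows : sumToᵀ (suc n) (λ i → sumToᵀ (suc (n ∸ i)) (g i)) T.≈ xsum (λ i → xsum (G i)) n
    by-rows = ΣT.sumTo-cong (suc n) λ i → ΣT.sumTo-cong (suc (n ∸ i)) λ m →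
      T.reflexive (≡.cong (G i m) (≡.sym (∸-+-assoc n i m)))

module CatalanSubstitution {c ℓ} (T : CommutativeRing c ℓ) where
  open PowerSeries T using (FPS; powerSeriesRing)
  open FormalXSums T
  open CommutativeRing powerSeriesRing
  open Series powerSeriesRing using (ι; sumTo)
  open FiniteSums powerSeriesRing using (sumTo-cong; sumTo-cong-<; *-distribʳ-sumTo)
  open IntegerCoefficients powerSeriesRing using (ι-1; ι-catalan-suc; signedBinomial; signedBinomial-pascal)
  open import Algebra.Properties.CommutativeSemiring.Exp commutativeSemiring using (_^_; ^-congˡ; ^-homo-*; ^-distrib-*)
  open import Algebra.Properties.CommutativeSemigroup *-commutativeSemigroup using (interchange; x∙yz≈y∙xz)
  open import Algebra.Properties.Ring ring using (x[y-z]≈xy-xz; -‿distribˡ-*)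
  open import Algebra.Properties.Group +-group using (x≈z//y)
  open import Relation.Binary.Reasoning.Setoid setoid

  catalanAt : FPS → FPS
  catalanAt h = xsum λ k → ι (catalan k) * h ^ k

  catalanAt-square : ∀ h → catalanAt h * catalanAt h ≈ xsum (λ n → ι (catalan (suc n)) * h ^ n)
  catalanAt-square h = begin
    catalanAt h * catalanAt h
      ≈⟨ *-distribˡ-xsum (catalanAt h) term ⟩
    xsum (λ k → catalanAt h * term k)
      ≈⟨ xsum-cong (λ k → trans (*-comm _ _) (*-distribˡ-xsum (term k) term)) ⟩
    xsum (λ i → xsum λ m → term i * term m)
      ≈⟨ sym (xsum-antidiagonals λ i m → term i * term m) ⟩
    xsum (λ n → sumTo (suc n) λ i → term i * term (n ∸ i))
      ≈⟨ xsum-cong convolution ⟩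
    xsum (λ n → ι (catalan (suc n)) * h ^ n) ∎
    where
    term : ℕ → FPS
    term k = ι (catalan k) * h ^ k
    convolution : ∀ n → sumTo (suc n) (λ i → term i * term (n ∸ i)) ≈ ι (catalan (suc n)) * h ^ n
    convolution n = begin
      sumTo (suc n) (λ i → term i * term (n ∸ i))
        ≈⟨ sumTo-cong-< (suc n) (λ {i} i<1+n → trans (interchange (ι (catalan i)) (h ^ i) (ι (catalan (n ∸ i))) (h ^ (n ∸ i))) (*-congˡ (trans
             (sym (^-homo-* h i (n ∸ i))) (reflexive (≡.cong (h ^_) (m+[n∸m]≡n (s≤s⁻¹ i<1+n))))))) ⟩
      sumTo (suc n) (λ i → (ι (catalan i) * ι (catalan (n ∸ i))) * h ^ n)
        ≈⟨ sym (*-distribʳ-sumTo (suc n) (h ^ n) λ i → ι (catalan i) * ι (catalan (n ∸ i))) ⟩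
      sumTo (suc n) (λ i → ι (catalan i) * ι (catalan (n ∸ i))) * h ^ n
        ≈⟨ *-congʳ {h ^ n} (sym (ι-catalan-suc n)) ⟩
      ι (catalan (suc n)) * h ^ n ∎

  catalanAt-equation : ∀ h → catalanAt h ≈ 1# + X * (h * (catalanAt h * catalanAt h))
  catalanAt-equation h = begin
    catalanAt h
      ≈⟨ xsum-suc (λ k → ι (catalan k) * h ^ k) ⟩
    ι 1 * 1# + X * xsum (λ k → ι (catalan (suc k)) * (h * h ^ k))
      ≈⟨ +-cong (trans (*-identityʳ _) ι-1) (*-congˡ (xsum-cong λ k → x∙yz≈y∙xz (ι (catalan (suc k))) h (h ^ k))) ⟩
    1# + X * xsum (λ k → h * (ι (catalan (suc k)) * h ^ k))
      ≈⟨ +-congˡ (*-congˡ (sym (*-distribˡ-xsum h λ k → ι (catalan (suc k)) * h ^ k))) ⟩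
    1# + X * (h * xsum (λ k → ι (catalan (suc k)) * h ^ k))
      ≈⟨ +-congˡ (*-congˡ (*-congˡ (sym (catalanAt-square h)))) ⟩
    1# + X * (h * (catalanAt h * catalanAt h)) ∎

  -- Multiplying C = 1 + x C², taken at x h, by h gives Z = h + x Z².
  catalanAt-inverse : ∀ h → let Z = h * catalanAt h in Z * (1# - X * Z) ≈ h
  catalanAt-inverse h = begin
    Z * (1# - X * Z)       ≈⟨ x[y-z]≈xy-xz Z 1# (X * Z) ⟩
    Z * 1# - Z * (X * Z)   ≈⟨ +-cong (*-identityʳ Z) (-‿cong (x∙yz≈y∙xz Z X Z)) ⟩
    Z - X * (Z * Z)        ≈⟨ sym (x≈z//y h (X * (Z * Z)) Z (sym Z≈h+XZ²)) ⟩
    h                      ∎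
    where
    P Z : FPS
    P = catalanAt h
    Z = h * P
    Z≈h+XZ² : Z ≈ h + X * (Z * Z)
    Z≈h+XZ² = begin
      h * P                             ≈⟨ *-congˡ (catalanAt-equation h) ⟩
      h * (1# + X * (h * (P * P)))      ≈⟨ distribˡ h 1# (X * (h * (P * P))) ⟩
      h * 1# + h * (X * (h * (P * P)))  ≈⟨ +-cong (*-identityʳ h) (x∙yz≈y∙xz h X (h * (P * P))) ⟩
      h + X * (h * (h * (P * P)))       ≈⟨ +-congˡ (*-congˡ (sym (trans (interchange h P h P) (*-assoc h h (P * P))))) ⟩
      h + X * (Z * Z)                   ∎

  xsum-binomial : FPS → ℕ → FPS
  xsum-binomial Z n = xsum λ m → signedBinomial n m * Z ^ m

  xsum-binomial-step : ∀ Z n → xsum-binomial Z (suc n) + X * (Z * xsum-binomial Z n) ≈ xsum-binomial Z n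
  xsum-binomial-step Z n = begin
    xsum-binomial Z (suc n) + X * (Z * S)
      ≈⟨ +-congʳ (xsum-suc (λ m → signedBinomial (suc n) m * Z ^ m)) ⟩
    (term 0 + X * xsum shifted) + X * (Z * S)
      ≈⟨ +-assoc (term 0) (X * xsum shifted) (X * (Z * S)) ⟩
    term 0 + (X * xsum shifted + X * (Z * S))
      ≈⟨ +-congˡ (sym (distribˡ X (xsum shifted) (Z * S))) ⟩
    term 0 + X * (xsum shifted + Z * S)
      ≈⟨ +-congˡ (*-congˡ {X} (+-congˡ {xsum shifted} (*-distribˡ-xsum Z term))) ⟩
    term 0 + X * (xsum shifted + xsum (λ m → Z * term m))
      ≈⟨ +-congˡ (*-congˡ (sym (xsum-distrib-+ shifted (λ m → Z * term m)))) ⟩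
    term 0 + X * xsum (λ m → shifted m + Z * term m)
      ≈⟨ +-congˡ (*-congˡ (xsum-cong pascal-term)) ⟩
    term 0 + X * xsum (term ∘ suc)
      ≈⟨ sym (xsum-suc term) ⟩
    S ∎
    where
    term shifted : ℕ → FPS
    term m    = signedBinomial n m * Z ^ m
    shifted m = signedBinomial (suc n) (suc m) * Z ^ suc m
    S : FPS
    S = xsum-binomial Z n
    pascal-term : ∀ m → shifted m + Z * term m ≈ term (suc m)
    pascal-term m = begin
      signedBinomial (suc n) (suc m) * Z ^ suc m + Z * (signedBinomial n m * Z ^ m)
        ≈⟨ +-congˡ (x∙yz≈y∙xz Z (signedBinomial n m) (Z ^ m)) ⟩
      signedBinomial (suc n) (suc m) * Z ^ suc m + signedBinomial n m * Z ^ suc m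
        ≈⟨ sym (distribʳ (Z ^ suc m) _ _) ⟩
      (signedBinomial (suc n) (suc m) + signedBinomial n m) * Z ^ suc m
        ≈⟨ *-congʳ {Z ^ suc m} (signedBinomial-pascal n m) ⟩
      signedBinomial n (suc m) * Z ^ suc m ∎

  binomial-theorem : ∀ Z n → (1# - X * Z) ^ n ≈ xsum-binomial Z n
  binomial-theorem Z zero    = sym (begin
    xsum-binomial Z 0
      ≈⟨ xsum-suc (λ m → signedBinomial 0 m * Z ^ m) ⟩
    signedBinomial 0 0 * 1# + X * xsum (λ m → signedBinomial 0 (suc m) * Z ^ suc m)
      ≈⟨ +-cong (trans (*-identityʳ _) (trans (*-identityˡ _) ι-1))
                (trans (*-congˡ (xsum-zero {λ m → signedBinomial 0 (suc m) * Z ^ suc m}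
                  λ m → trans (*-congʳ {Z ^ suc m} (zeroʳ _)) (zeroˡ (Z ^ suc m)))) (zeroʳ X)) ⟩
    1# + 0#
      ≈⟨ +-identityʳ 1# ⟩
    1# ∎)
  binomial-theorem Z (suc n) = begin
    (1# - X * Z) * (1# - X * Z) ^ n    ≈⟨ *-congˡ (binomial-theorem Z n) ⟩
    (1# - X * Z) * S                   ≈⟨ distribʳ S 1# (- (X * Z)) ⟩
    1# * S + - (X * Z) * S             ≈⟨ +-cong (*-identityˡ S) (trans (sym (-‿distribˡ-* (X * Z) S)) (-‿cong (*-assoc X Z S))) ⟩
    S - X * (Z * S)                    ≈⟨ sym (x≈z//y _ _ S (xsum-binomial-step Z n)) ⟩
    xsum-binomial Z (suc n)            ∎
    where
    S : FPS
    S = xsum-binomial Z n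

  power-expansion : ∀ h i → let Z = h * catalanAt h in
    h ^ suc i ≈ xsum (λ m → signedBinomial (suc i) m * Z ^ (suc i ℕ.+ m))
  power-expansion h i = begin
    h ^ suc i                              ≈⟨ ^-congˡ (suc i) (sym (catalanAt-inverse h)) ⟩
    (Z * (1# - X * Z)) ^ suc i             ≈⟨ ^-distrib-* Z (1# - X * Z) (suc i) ⟩
    Z ^ suc i * (1# - X * Z) ^ suc i       ≈⟨ *-congˡ (binomial-theorem Z (suc i)) ⟩
    Z ^ suc i * xsum-binomial Z (suc i)    ≈⟨ *-distribˡ-xsum (Z ^ suc i) (λ m → signedBinomial (suc i) m * Z ^ m) ⟩
    xsum (λ m → Z ^ suc i * (signedBinomial (suc i) m * Z ^ m))
      ≈⟨ xsum-cong (λ m → trans (x∙yz≈y∙xz (Z ^ suc i) _ (Z ^ m)) (*-congˡ (sym (^-homo-* Z (suc i) m)))) ⟩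
    xsum (λ m → signedBinomial (suc i) m * Z ^ (suc i ℕ.+ m)) ∎
    where
    Z : FPS
    Z = h * catalanAt h

  runTransform-expansion : ∀ h (β : ℕ → FPS) → let Z = h * catalanAt h in
    h * xsum (λ k → β k * h ^ k) ≈
    xsum (λ k → sumTo (suc k) (λ i → β i * signedBinomial (suc i) (k ∸ i)) * Z ^ suc k)
  runTransform-expansion h β = begin
    h * xsum (λ k → β k * h ^ k)
      ≈⟨ *-distribˡ-xsum h (λ k → β k * h ^ k) ⟩
    xsum (λ k → h * (β k * h ^ k))
      ≈⟨ xsum-cong (λ k → x∙yz≈y∙xz h (β k) (h ^ k)) ⟩
    xsum (λ i → β i * h ^ suc i)
      ≈⟨ xsum-cong (λ i → trans (*-congˡ (power-expansion h i)) (*-distribˡ-xsum (β i) λ m → signedBinomial (suc i) m * Z ^ (suc i ℕ.+ m))) ⟩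
    xsum (λ i → xsum λ m → β i * (signedBinomial (suc i) m * Z ^ (suc i ℕ.+ m)))
      ≈⟨ sym (xsum-antidiagonals λ i m → β i * (signedBinomial (suc i) m * Z ^ (suc i ℕ.+ m))) ⟩
    xsum (λ k → sumTo (suc k) λ i → β i * (signedBinomial (suc i) (k ∸ i) * Z ^ (suc i ℕ.+ (k ∸ i))))
      ≈⟨ xsum-cong collect ⟩
    xsum (λ k → sumTo (suc k) (λ i → β i * signedBinomial (suc i) (k ∸ i)) * Z ^ suc k) ∎
    where
    Z : FPS
    Z = h * catalanAt h
    collect : ∀ k → sumTo (suc k) (λ i → β i * (signedBinomial (suc i) (k ∸ i) * Z ^ (suc i ℕ.+ (k ∸ i))))
                    ≈ sumTo (suc k) (λ i → β i * signedBinomial (suc i) (k ∸ i)) * Z ^ suc k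
    collect k = trans (sumTo-cong-< (suc k) λ {i} i<1+k → trans
        (sym (*-assoc (β i) (signedBinomial (suc i) (k ∸ i)) (Z ^ (suc i ℕ.+ (k ∸ i)))))
        (*-congˡ {β i * signedBinomial (suc i) (k ∸ i)}
          (reflexive (≡.cong (λ j → Z ^ suc j) (m+[n∸m]≡n (s≤s⁻¹ i<1+k))))))
      (sym (*-distribʳ-sumTo (suc k) (Z ^ suc k) λ i → β i * signedBinomial (suc i) (k ∸ i)))

module BivariateRunTransform {c ℓ} (R : CommutativeRing c ℓ) where
  private
    module R = CommutativeRing R
  open Series R

  R⟦y⟧ : CommutativeRing c ℓ
  R⟦y⟧ = PowerSeries.powerSeriesRing R

  -- The carrier of R⟦y⟧⟦x⟧ is FPS2, the outer index being the exponent of x.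
  R⟦y⟧⟦x⟧ : CommutativeRing c ℓ
  R⟦y⟧⟦x⟧ = PowerSeries.powerSeriesRing R⟦y⟧

  open CommutativeRing R⟦y⟧⟦x⟧
  open FormalXSums R⟦y⟧ renaming (xsum to xsumₓ)
  open CatalanSubstitution R⟦y⟧
  open import Algebra.Properties.CommutativeSemiring.Exp commutativeSemiring using (_^_)

  φ : R.Carrier → FPS2
  φ = PowerSeries.const R⟦y⟧ ∘ PowerSeries.const R

  φ-isRingHomomorphism : RingMorphisms.IsRingHomomorphism R.rawRing rawRing φ
  φ-isRingHomomorphism = Composition.isRingHomomorphism trans
    (PowerSeries.const-isRingHomomorphism R) (PowerSeries.const-isRingHomomorphism R⟦y⟧)

  open RingMorphisms.IsRingHomomorphism φ-isRingHomomorphism using (*-homo)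
  open RingHomomorphismLemmas R R⟦y⟧⟦x⟧ φ-isRingHomomorphism

  ⊛≈* : ∀ F G → F ⊛ G ≈ F * G
  ⊛≈* F G i j = R.sym (PowerSeries.coeff-sumTo R (suc i) _ j)

  ^ˢ≈^ : ∀ F n → F ^ˢ n ≈ F ^ n
  ^ˢ≈^ F zero    = one≈1
    where
    one≈1 : one ≈ 1#
    one≈1 zero    zero    = R.refl
    one≈1 zero    (suc j) = R.refl
    one≈1 (suc i) j       = R.refl
  ^ˢ≈^ F (suc n) = trans (⊛≈* F (F ^ˢ n)) (*-congˡ (^ˢ≈^ F n))

  xsum-• : ∀ (a : ℕ → R.Carrier) (G : ℕ → FPS2) → xsum (λ k → a k • G k) ≈ xsumₓ (λ k → φ (a k) * G k)
  xsum-• a G i j = R.trans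
    (FiniteSums.sumTo-cong R (suc i) λ k → R.sym (R.trans
      (PowerSeries.const-*ₚ R⟦y⟧ (PowerSeries.const R (a k)) (G k) (i ∸ k) j)
      (PowerSeries.const-*ₚ R (a k) (G k (i ∸ k)) j)))
    (R.sym (PowerSeries.coeff-sumTo R (suc i) (λ k → (φ (a k) * G k) (i ∸ k)) j))

  Φ≈ : ∀ b → Φ b ≈ h * xsumₓ (λ k → φ (b k) * h ^ k)
  Φ≈ b = trans (⊛≈* h (substXh b)) (*-congˡ (trans (xsum-• b (h ^ˢ_))
           (xsum-cong λ k → *-congˡ (^ˢ≈^ h k))))

  Cxy≈ : Cxy ≈ h * catalanAt h
  Cxy≈ = trans (Φ≈ (ι ∘ catalan)) (*-congˡ (xsum-cong λ k → *-congʳ {h ^ k} (homo-ι (catalan k))))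

  Cinv-upper : ∀ {i j} → i ≤ j → Cinv i j ≡.≡ IntegerCoefficients.signedBinomial R (suc i) (j ∸ i)
  Cinv-upper {i} {j} i≤j with i ℕ.≤? j
  ... | yes _   = ≡.refl
  ... | no  i≰j = contradiction i≤j i≰j

  φ-rowTimesCinv : ∀ b k → φ (rowTimesCinv b k) ≈
    Series.sumTo R⟦y⟧⟦x⟧ (suc k) (λ i → φ (b i) * IntegerCoefficients.signedBinomial R⟦y⟧⟦x⟧ (suc i) (k ∸ i))
  φ-rowTimesCinv b k = trans (homo-sumTo (suc k) _) (FiniteSums.sumTo-cong-< R⟦y⟧⟦x⟧ (suc k) λ {i} i<1+k →
    trans (*-homo _ _) (*-congˡ (trans (reflexive (≡.cong φ (Cinv-upper (s≤s⁻¹ i<1+k))))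
      (homo-signedBinomial (suc i) (k ∸ i)))))

proposition2 : ∀ {c ℓ} (R : CommutativeRing c ℓ) (b : ℕ → CommutativeRing.Carrier R) →
    let open Series R in
    Φ b ≈ˢ xsum (λ k → rowTimesCinv b k • (Cxy ^ˢ suc k))
proposition2 R b = begin
  Φ b
    ≈⟨ Φ≈ b ⟩
  h * xsumₓ (λ k → φ (b k) * h ^ k)
    ≈⟨ runTransform-expansion h (φ ∘ b) ⟩
  xsumₓ (λ k → sumTo (suc k) (λ i → φ (b i) * signedBinomial (suc i) (k ∸ i)) * (h * catalanAt h) ^ suc k)
    ≈⟨ xsum-cong (λ k → *-cong (sym (φ-rowTimesCinv b k)) (^-congˡ (suc k) (sym Cxy≈))) ⟩
  xsumₓ (λ k → φ (rowTimesCinv b k) * Cxy ^ suc k)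
    ≈⟨ xsum-cong (λ k → *-congˡ (sym (^ˢ≈^ Cxy (suc k)))) ⟩
  xsumₓ (λ k → φ (rowTimesCinv b k) * Cxy ^ˢ suc k)
    ≈⟨ sym (xsum-• (rowTimesCinv b) λ k → Cxy ^ˢ suc k) ⟩
  xsum (λ k → rowTimesCinv b k • (Cxy ^ˢ suc k)) ∎
  where
  open Series R using (Φ; h; Cxy; rowTimesCinv; _•_; _^ˢ_; xsum)
  open BivariateRunTransform R
  open CommutativeRing R⟦y⟧⟦x⟧ using (_*_; *-cong; *-congˡ; sym; trans)
  open Series R⟦y⟧⟦x⟧ using (sumTo)
  open FormalXSums R⟦y⟧ using (xsum-cong) renaming (xsum to xsumₓ)
  open CatalanSubstitution R⟦y⟧ using (runTransform-expansion; catalanAt)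
  open IntegerCoefficients R⟦y⟧⟦x⟧ using (signedBinomial)
  open import Algebra.Properties.CommutativeSemiring.Exp (CommutativeRing.commutativeSemiring R⟦y⟧⟦x⟧)
    using (_^_; ^-congˡ)
  open import Relation.Binary.Reasoning.Setoid (CommutativeRing.setoid R⟦y⟧⟦x⟧)
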